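{- Consider the following six cubic graphs on the vertex set $\{1,2,\dots,8\}$: $G_1$ with edges $12,17,18,23,24,34,35,45,56,67,68,78$; $G_2$ with edges $12,23,34,45,56,67,78,81,15,27,38,46$; $G_3$ with edges $12,23,34,45,56,67,78,81,15,26,37,48$; $G_4$ with edges $12,23,34,45,56,67,78,81,15,24,37,68$; $G_5$ with edges $12,23,34,45,56,67,78,81,16,25,38,47$; $G_6$ with edges $12,13,14,23,24,34,56,57,58,67,68,78$ (two disjoint copies of $K_4$). (These are, up to isomorphism, all cubic graphs of order $8$.) Then (i) $d_{\rm st}(G_1)=d_{\rm st}(G_5)=d_{\rm st}(G_6)=4$; (ii) $d_{\rm st}(G_2)=d_{\rm st}(G_3)=2$; (iii) $d_{\rm st}(G_4)=3$.
   Context: For a finite simple graph $G=(V,E)$, a set $D\subseteq V$ is a strong dominating set if for every vertex $x\in V\setminus D$ there is a vertex $y\in D$ with $xy\in E$ and $\deg(x)\le \deg(y)$. A strong domatic partition of $G$ is a partition of $V(G)$ all of whose classes are strong dominating sets of $G$. The strong domatic number $d_{\rm st}(G)$ is the maximum number of classes of a strong domatic partition of $G$. An edge $ij$ denotes the edge joining vertices $i$ and $j$. -}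

module Defs where

open import Data.Nat using (ℕ; suc; _≤_; _≡ᵇ_)
open import Data.Bool using (Bool; true; false; _∧_; _∨_)
open import Data.Fin using (Fin; toℕ)
open import Data.List using (List; []; _∷_; length; filterᵇ; allFin)
open import Data.Bool.ListAction using (any)
open import Data.Empty using (⊥)
open import Data.Product using (_×_; _,_; Σ; ∃)
open import Relation.Binary.PropositionalEquality using (_≡_)

-- A finite simple graph on the vertex set {1,…,n}, given by its list of edges
-- (unordered pairs of labels, written as ordered pairs).  Vertex x : Fin n
-- stands for the label  toℕ x + 1.
record Graph (n : ℕ) : Set where
  constructor graph
  field edges : List (ℕ × ℕ)
open Graph public

label : ∀ {n} → Fin n → ℕ
label x = suc (toℕ x)

adjᵇ : ∀ {n} → Graph n → Fin n → Fin n → Bool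
adjᵇ G x y = any (λ { (a , b) → ((label x ≡ᵇ a) ∧ (label y ≡ᵇ b))
                                ∨ ((label x ≡ᵇ b) ∧ (label y ≡ᵇ a)) }) (edges G)

Adj : ∀ {n} → Graph n → Fin n → Fin n → Set
Adj G x y = adjᵇ G x y ≡ true

deg : ∀ {n} → Graph n → Fin n → ℕ
deg {n} G x = length (filterᵇ (adjᵇ G x) (allFin n))

IsStrongDominating : ∀ {n} → Graph n → (Fin n → Set) → Set
IsStrongDominating {n} G D =
  (x : Fin n) → (D x → ⊥) → ∃ λ y → D y × Adj G x y × deg G x ≤ deg G y

IsStrongDomaticPartition : ∀ {n} → Graph n → (k : ℕ) → (Fin n → Fin k) → Set
IsStrongDomaticPartition {n} G k f =
  ((c : Fin k) → ∃ λ x → f x ≡ c) ×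
  ((c : Fin k) → IsStrongDominating G (λ x → f x ≡ c))

HasStrongDomaticPartition : ∀ {n} → Graph n → ℕ → Set
HasStrongDomaticPartition {n} G k = ∃ λ (f : Fin n → Fin k) → IsStrongDomaticPartition G k f

StrongDomaticNumber : ∀ {n} → Graph n → ℕ → Set
StrongDomaticNumber G k =
  HasStrongDomaticPartition G k × (∀ m → HasStrongDomaticPartition G m → m ≤ k)

G₁ G₂ G₃ G₄ G₅ G₆ : Graph 8
G₁ = graph ((1 , 2) ∷ (1 , 7) ∷ (1 , 8) ∷ (2 , 3) ∷ (2 , 4) ∷ (3 , 4) ∷ (3 , 5) ∷ (4 , 5) ∷ (5 , 6) ∷ (6 , 7) ∷ (6 , 8) ∷ (7 , 8) ∷ [])
G₂ = graph ((1 , 2) ∷ (2 , 3) ∷ (3 , 4) ∷ (4 , 5) ∷ (5 , 6) ∷ (6 , 7) ∷ (7 , 8) ∷ (8 , 1) ∷ (1 , 5) ∷ (2 , 7) ∷ (3 , 8) ∷ (4 , 6) ∷ [])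
G₃ = graph ((1 , 2) ∷ (2 , 3) ∷ (3 , 4) ∷ (4 , 5) ∷ (5 , 6) ∷ (6 , 7) ∷ (7 , 8) ∷ (8 , 1) ∷ (1 , 5) ∷ (2 , 6) ∷ (3 , 7) ∷ (4 , 8) ∷ [])
G₄ = graph ((1 , 2) ∷ (2 , 3) ∷ (3 , 4) ∷ (4 , 5) ∷ (5 , 6) ∷ (6 , 7) ∷ (7 , 8) ∷ (8 , 1) ∷ (1 , 5) ∷ (2 , 4) ∷ (3 , 7) ∷ (6 , 8) ∷ [])
G₅ = graph ((1 , 2) ∷ (2 , 3) ∷ (3 , 4) ∷ (4 , 5) ∷ (5 , 6) ∷ (6 , 7) ∷ (7 , 8) ∷ (8 , 1) ∷ (1 , 6) ∷ (2 , 5) ∷ (3 , 8) ∷ (4 , 7) ∷ [])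
G₆ = graph ((1 , 2) ∷ (1 , 3) ∷ (1 , 4) ∷ (2 , 3) ∷ (2 , 4) ∷ (3 , 4) ∷ (5 , 6) ∷ (5 , 7) ∷ (5 , 8) ∷ (6 , 7) ∷ (6 , 8) ∷ (7 , 8) ∷ [])

-- Every strong dominating set is in particular dominating, so each class of a
-- strong domatic partition meets every closed neighbourhood N[x].  Hence there
-- are at most deg x + 1 classes, which is 4 for cubic graphs and settles
-- G₁, G₅, G₆.  For G₂ and G₃ (resp. G₄) an exhaustive search over the 3⁸
-- (resp. 4⁸) colourings shows that no colouring lets every closed
-- neighbourhood see 3 (resp. 4) colours.  Merging two classes of a strong
-- domatic partition gives one with a class fewer, so these bounds cap d_st,
-- and explicit partitions attain them.
module Submission where

open import Defs
open import Data.Bool as Bool using (Bool; true; T; not)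
open import Data.Bool.Properties using (T-not-≡)
open import Data.Bool.ListAction using (all; any)
open import Data.Fin using (Fin; zero; suc; pinch; _≟_; #_)
open import Data.Fin.Properties using (all?; any?; injective⇒≤)
open import Data.List as List using (List; []; _∷_; filterᵇ; allFin)
open import Data.List.Membership.Propositional using (lose)
open import Data.List.Membership.Propositional.Properties using (∈-filter⁺; ∈-allFin)
open import Data.List.Relation.Unary.All.Properties using (all⁺; all⁻; tabulate⁺; tabulate⁻)
open import Data.List.Relation.Unary.Any as Any using (Any; here; there)
open import Data.List.Relation.Unary.Any.Properties using (lookup-index; any⁺)
open import Data.Nat using (ℕ; zero; suc; _≤_; _≤′_; ≤′-reflexive; ≤′-step; _≤?_)
open import Data.Nat.Properties using (≰⇒>; ≤⇒≤′; 1+n≰n)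
open import Data.Product using (_×_; _,_; ∃)
open import Data.Vec as Vec using (Vec; []; _∷_; lookup)
open import Data.Vec.Properties using (lookup∘tabulate)
open import Function using (_∘_; id; Equivalence)
open import Relation.Binary.PropositionalEquality using (_≡_; _≗_; refl; sym; trans; cong; subst)
open import Relation.Nullary using (Dec; yes; no; ¬_; ¬?; contradiction)
open import Relation.Nullary.Decidable using (True; toWitness; fromWitness; T?; _×-dec_; _→-dec_; ⌊_⌋)
open import Relation.Unary using (Decidable)

private
  variable
    n k m : ℕ

closedNeighbours : Graph n → Fin n → List (Fin n)
closedNeighbours {n} G x = x ∷ filterᵇ (adjᵇ G x) (allFin n)

IsStrongDominating-⊆ : ∀ (G : Graph n) {D E} → (∀ x → D x → E x) →
                       IsStrongDominating G D → IsStrongDominating G E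
IsStrongDominating-⊆ G D⊆E dom x x∉E with dom x (x∉E ∘ D⊆E x)
... | y , Dy , xy , degx≤degy = y , D⊆E y Dy , xy , degx≤degy

strongDominating⇒meetsClosedNeighbours : ∀ (G : Graph n) {D} → Decidable D →
  IsStrongDominating G D → ∀ x → Any D (closedNeighbours G x)
strongDominating⇒meetsClosedNeighbours G D? dom x with D? x
... | yes Dx = here Dx
... | no ¬Dx with dom x ¬Dx
...   | y , Dy , xy , _ =
  there (lose (∈-filter⁺ (T? ∘ adjᵇ G x) (∈-allFin y) (subst T (sym xy) _)) Dy)

IsDomaticColouring : Graph n → (k : ℕ) → (Fin n → Fin k) → Set
IsDomaticColouring G k f = ∀ x (c : Fin k) → Any (λ y → f y ≡ c) (closedNeighbours G x)

strongDomaticPartition⇒domaticColouring : ∀ (G : Graph n) {f : Fin n → Fin k} →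
  IsStrongDomaticPartition G k f → IsDomaticColouring G k f
strongDomaticPartition⇒domaticColouring G {f} (_ , dom) x c =
  strongDominating⇒meetsClosedNeighbours G (λ y → f y ≟ c) (dom c) x

-- A colour is sent to the position in N[x] of a vertex carrying it.
domaticColouring-≤1+deg : ∀ (G : Graph n) {f : Fin n → Fin k} →
  IsDomaticColouring G k f → ∀ x → k ≤ suc (deg G x)
domaticColouring-≤1+deg G {f} sees x = injective⇒≤ position-injective
  where
  position : Fin _ → Fin (suc (deg G x))
  position c = Any.index (sees x c)

  position-injective : ∀ {c d} → position c ≡ position d → c ≡ d
  position-injective {c} {d} eq =
    trans (sym (lookup-index (sees x c)))
          (trans (cong (f ∘ List.lookup (closedNeighbours G x)) eq) (lookup-index (sees x d)))

¬strongDomaticPartition-2+deg : ∀ (G : Graph n) x →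
  ¬ HasStrongDomaticPartition G (suc (suc (deg G x)))
¬strongDomaticPartition-2+deg G x (_ , partition) =
  1+n≰n (domaticColouring-≤1+deg G (strongDomaticPartition⇒domaticColouring G partition) x)

-- pinch zero merges the classes 0 and 1; class suc c lies inside the new class c.
strongDomaticPartition-pred : ∀ (G : Graph n) → HasStrongDomaticPartition G (suc (suc k)) →
                              HasStrongDomaticPartition G (suc k)
strongDomaticPartition-pred G (f , nonempty , dom) =
  pinch zero ∘ f , inhabited , λ c → IsStrongDominating-⊆ G (λ x → cong (pinch zero)) (dom (suc c))
  where
  inhabited : ∀ c → ∃ λ x → pinch zero (f x) ≡ c
  inhabited c with nonempty (suc c)
  ... | x , fx≡succ = x , cong (pinch zero) fx≡succ

strongDomaticPartition-≤′ : ∀ (G : Graph n) → suc k ≤′ m →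
  HasStrongDomaticPartition G m → HasStrongDomaticPartition G (suc k)
strongDomaticPartition-≤′ G (≤′-reflexive refl)              = id
strongDomaticPartition-≤′ G (≤′-step {zero} (≤′-reflexive ()))
strongDomaticPartition-≤′ G (≤′-step {suc _} k<m)            =
  strongDomaticPartition-≤′ G k<m ∘ strongDomaticPartition-pred G

strongDomaticNumber-intro : ∀ (G : Graph n) → HasStrongDomaticPartition G k →
  ¬ HasStrongDomaticPartition G (suc k) → StrongDomaticNumber G k
strongDomaticNumber-intro {k = k} G has ¬has = has , bounded
  where
  bounded : ∀ m → HasStrongDomaticPartition G m → m ≤ k
  bounded m hasₘ with m ≤? k
  ... | yes m≤k = m≤k
  ... | no m≰k  = contradiction (strongDomaticPartition-≤′ G (≤⇒≤′ (≰⇒> m≰k)) hasₘ) ¬has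

isStrongDominating? : ∀ (G : Graph n) {D} → Decidable D → Dec (IsStrongDominating G D)
isStrongDominating? G D? =
  all? λ x → ¬? (D? x) →-dec
    any? λ y → D? y ×-dec (adjᵇ G x y Bool.≟ true) ×-dec (deg G x ≤? deg G y)

isStrongDomaticPartition? : ∀ (G : Graph n) k f → Dec (IsStrongDomaticPartition G k f)
isStrongDomaticPartition? G k f =
  (all? λ c → any? λ x → f x ≟ c) ×-dec (all? λ c → isStrongDominating? G (λ x → f x ≟ c))

strongDomaticPartition-lookup : ∀ (G : Graph n) (classes : Vec (Fin k) n) →
  {True (isStrongDomaticPartition? G k (lookup classes))} → HasStrongDomaticPartition G k
strongDomaticPartition-lookup G classes {valid} = lookup classes , toWitness valid

allVecᵇ : ∀ n → (Vec (Fin k) n → Bool) → Bool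
allVecᵇ     zero    p = p []
allVecᵇ {k} (suc n) p = all (λ a → allVecᵇ n (p ∘ (a ∷_))) (allFin k)

allVecᵇ-sound : ∀ n (p : Vec (Fin k) n → Bool) → T (allVecᵇ n p) → ∀ v → T (p v)
allVecᵇ-sound zero    p holds []      = holds
allVecᵇ-sound (suc n) p holds (a ∷ v) =
  allVecᵇ-sound n (p ∘ (a ∷_)) (tabulate⁻ (all⁺ _ (allFin _) holds) a) v

isDomaticColouringᵇ : Vec (List (Fin n)) n → (Fin n → Fin k) → Bool
isDomaticColouringᵇ {n} {k} N f =
  all (λ x → all (λ c → any (λ y → ⌊ f y ≟ c ⌋) (lookup N x)) (allFin k)) (allFin n)

isDomaticColouringᵇ-complete : ∀ (G : Graph n) {f : Fin n → Fin k} →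
  IsDomaticColouring G k f → T (isDomaticColouringᵇ (Vec.tabulate (closedNeighbours G)) f)
isDomaticColouringᵇ-complete G sees =
  all⁻ _ (tabulate⁺ λ x → all⁻ _ (tabulate⁺ λ c →
    any⁺ _ (subst (Any _) (sym (lookup∘tabulate (closedNeighbours G) x))
                  (Any.map fromWitness (sees x c)))))

IsDomaticColouring-resp-≗ : ∀ (G : Graph n) {f g : Fin n → Fin k} → f ≗ g →
  IsDomaticColouring G k f → IsDomaticColouring G k g
IsDomaticColouring-resp-≗ G f≗g sees x c = Any.map (λ {y} → trans (sym (f≗g y))) (sees x c)

-- N is the table of closed neighbourhoods of G, written out so that the search
-- below does not recompute it for every colouring.
¬strongDomaticPartition-search : ∀ (G : Graph n) (N : Vec (List (Fin n)) n) →
  Vec.tabulate (closedNeighbours G) ≡ N →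
  T (allVecᵇ n (λ v → not (isDomaticColouringᵇ {k = k} N (lookup v)))) →
  ¬ HasStrongDomaticPartition G k
¬strongDomaticPartition-search {n} G N refl noColouring (f , partition) =
  subst T (Equivalence.to T-not-≡ (allVecᵇ-sound n _ noColouring (Vec.tabulate f))) colours
  where
  colours : T (isDomaticColouringᵇ N (lookup (Vec.tabulate f)))
  colours = isDomaticColouringᵇ-complete G
    (IsDomaticColouring-resp-≗ G (sym ∘ lookup∘tabulate f)
      (strongDomaticPartition⇒domaticColouring G partition))

closedNeighbours₂ closedNeighbours₃ closedNeighbours₄ : Vec (List (Fin 8)) 8
closedNeighbours₂ =
    (# 0 ∷ # 1 ∷ # 4 ∷ # 7 ∷ [])
  ∷ (# 1 ∷ # 0 ∷ # 2 ∷ # 6 ∷ [])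
  ∷ (# 2 ∷ # 1 ∷ # 3 ∷ # 7 ∷ [])
  ∷ (# 3 ∷ # 2 ∷ # 4 ∷ # 5 ∷ [])
  ∷ (# 4 ∷ # 0 ∷ # 3 ∷ # 5 ∷ [])
  ∷ (# 5 ∷ # 3 ∷ # 4 ∷ # 6 ∷ [])
  ∷ (# 6 ∷ # 1 ∷ # 5 ∷ # 7 ∷ [])
  ∷ (# 7 ∷ # 0 ∷ # 2 ∷ # 6 ∷ [])
  ∷ []
closedNeighbours₃ =
    (# 0 ∷ # 1 ∷ # 4 ∷ # 7 ∷ [])
  ∷ (# 1 ∷ # 0 ∷ # 2 ∷ # 5 ∷ [])
  ∷ (# 2 ∷ # 1 ∷ # 3 ∷ # 6 ∷ [])
  ∷ (# 3 ∷ # 2 ∷ # 4 ∷ # 7 ∷ [])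
  ∷ (# 4 ∷ # 0 ∷ # 3 ∷ # 5 ∷ [])
  ∷ (# 5 ∷ # 1 ∷ # 4 ∷ # 6 ∷ [])
  ∷ (# 6 ∷ # 2 ∷ # 5 ∷ # 7 ∷ [])
  ∷ (# 7 ∷ # 0 ∷ # 3 ∷ # 6 ∷ [])
  ∷ []
closedNeighbours₄ =
    (# 0 ∷ # 1 ∷ # 4 ∷ # 7 ∷ [])
  ∷ (# 1 ∷ # 0 ∷ # 2 ∷ # 3 ∷ [])
  ∷ (# 2 ∷ # 1 ∷ # 3 ∷ # 6 ∷ [])
  ∷ (# 3 ∷ # 1 ∷ # 2 ∷ # 4 ∷ [])
  ∷ (# 4 ∷ # 0 ∷ # 3 ∷ # 5 ∷ [])
  ∷ (# 5 ∷ # 4 ∷ # 6 ∷ # 7 ∷ [])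
  ∷ (# 6 ∷ # 2 ∷ # 5 ∷ # 7 ∷ [])
  ∷ (# 7 ∷ # 0 ∷ # 5 ∷ # 6 ∷ [])
  ∷ []

theorem3p2 : (StrongDomaticNumber G₁ 4 × StrongDomaticNumber G₅ 4 × StrongDomaticNumber G₆ 4)
           × (StrongDomaticNumber G₂ 2 × StrongDomaticNumber G₃ 2)
           × StrongDomaticNumber G₄ 3
theorem3p2 =
  ( strongDomaticNumber-intro G₁
      (strongDomaticPartition-lookup G₁ (# 0 ∷ # 1 ∷ # 2 ∷ # 3 ∷ # 0 ∷ # 1 ∷ # 2 ∷ # 3 ∷ []))
      (¬strongDomaticPartition-2+deg G₁ zero)
  , strongDomaticNumber-intro G₅
      (strongDomaticPartition-lookup G₅ (# 0 ∷ # 1 ∷ # 2 ∷ # 0 ∷ # 3 ∷ # 2 ∷ # 1 ∷ # 3 ∷ []))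
      (¬strongDomaticPartition-2+deg G₅ zero)
  , strongDomaticNumber-intro G₆
      (strongDomaticPartition-lookup G₆ (# 0 ∷ # 1 ∷ # 2 ∷ # 3 ∷ # 0 ∷ # 1 ∷ # 2 ∷ # 3 ∷ []))
      (¬strongDomaticPartition-2+deg G₆ zero) )
  , ( strongDomaticNumber-intro G₂
        (strongDomaticPartition-lookup G₂ (# 0 ∷ # 0 ∷ # 0 ∷ # 0 ∷ # 0 ∷ # 1 ∷ # 1 ∷ # 1 ∷ []))
        (¬strongDomaticPartition-search G₂ closedNeighbours₂ refl _)
    , strongDomaticNumber-intro G₃
        (strongDomaticPartition-lookup G₃ (# 0 ∷ # 0 ∷ # 0 ∷ # 0 ∷ # 0 ∷ # 1 ∷ # 1 ∷ # 1 ∷ []))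
        (¬strongDomaticPartition-search G₃ closedNeighbours₃ refl _) )
  , strongDomaticNumber-intro G₄
      (strongDomaticPartition-lookup G₄ (# 0 ∷ # 0 ∷ # 1 ∷ # 2 ∷ # 1 ∷ # 0 ∷ # 1 ∷ # 2 ∷ []))
      (¬strongDomaticPartition-search G₄ closedNeighbours₄ refl _)
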